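{- Let $v\geq 9$. Then there exists a connected symmetric configuration $v_3$ which, for every integer $q$ with $\lceil v/3\rceil\leq q\leq\lfloor 2v/3\rfloor$, has a blocking set of cardinality $q$.
   Context: A symmetric configuration $v_3$ is a finite incidence structure consisting of a set $V$ of $v$ points and a collection of $v$ blocks, each block a $3$-element subset of $V$, such that each point lies in exactly $3$ blocks and any two distinct points lie together in at most one block. It is connected if it is not the union of two configurations on disjoint point sets (equivalently, its point–block incidence graph is connected). A blocking set is a subset $Q\subseteq V$ such that every block contains at least one point of $Q$ and at least one point of $V\setminus Q$. -}

module Defs where

open import Data.Nat using (ℕ; suc; _+_; _*_; _/_; _≤_)
open import Data.Fin using (Fin; _≟_)
open import Data.Fin.Subset using (Subset; _∈_; _∉_; ∣_∣)
open import Data.Product using (Σ; ∃; ∃-syntax; _×_; _,_)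
open import Data.List using (List; length; filter; allFin)
open import Data.Bool using (Bool)
open import Relation.Nullary using (¬_; Dec)
open import Relation.Binary.PropositionalEquality using (_≡_)
open import Function.Definitions using (Injective)

record Structure (v : ℕ) : Set where
  field
    block : Fin v → Fin 3 → Fin v

open Structure public

_∈B_ : ∀ {v} → Fin v → (Fin v → Fin 3 → Fin v) → Fin v → Set
(p ∈B blk) b = ∃[ i ] blk b i ≡ p

incident? : ∀ {v} (C : Structure v) (p b : Fin v) → Dec ((p ∈B block C) b)
incident? C p b = Data.Fin.Properties.any? (λ i → block C b i ≟ p)
  where import Data.Fin.Properties

blocksThrough : ∀ {v} → Structure v → Fin v → List (Fin v)
blocksThrough C p = filter (incident? C p) (allFin _)

blocksThrough₂ : ∀ {v} → Structure v → Fin v → Fin v → List (Fin v)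
blocksThrough₂ C p q =
  filter (λ b → incident? C p b Relation.Nullary.×-dec incident? C q b) (allFin _)

record IsConfiguration {v : ℕ} (C : Structure v) : Set where
  field
    blockDistinct : ∀ b → Injective _≡_ _≡_ (block C b)
    threeBlocks   : ∀ p → length (blocksThrough C p) ≡ 3
    atMostOne     : ∀ p q → ¬ p ≡ q → length (blocksThrough₂ C p q) ≤ 1

-- connectivity of the point–block incidence graph, via reachability between
-- points (two points are adjacent when they share a block)
data Reach {v : ℕ} (C : Structure v) : Fin v → Fin v → Set where
  here : ∀ {p} → Reach C p p
  step : ∀ {p q r} b → (p ∈B block C) b → (q ∈B block C) b → Reach C q r → Reach C p r

Connected : ∀ {v} → Structure v → Set
Connected C = ∀ p q → Reach C p q

IsBlockingSet : ∀ {v} → Structure v → Subset v → Set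
IsBlockingSet C Q = ∀ b → (∃[ i ] block C b i ∈ Q) × (∃[ i ] block C b i ∉ Q)

⌈_/3⌉ : ℕ → ℕ
⌈ v /3⌉ = (v + 2) / 3

⌊2_/3⌋ : ℕ → ℕ
⌊2 v /3⌋ = (2 * v) / 3

-- Every v ≥ 9 is 9, 10 or 11 plus a multiple of 3. The three base configurations are checked by
-- computation. The step v ↦ v + 3 takes three pairwise disjoint blocks B₀, B₁, B₂ (the anchors),
-- replaces the j-th point x_j of B_j by a new point n_j and adds the three blocks
-- {x_j} ∪ {n_i | i ≠ j}; every point still lies on three blocks, two points still share at most one
-- block, and connectivity survives. Blocking sets come from a labelling of the points as forcedIn,
-- free or forcedOut in which every block has a forcedIn and a forcedOut point: then every set
-- containing all forcedIn and no forcedOut points is blocking. Labelling n₀, n₁, n₂ as forcedIn,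
-- free, forcedOut preserves this, and adding n₀, or n₀ and n₁, to the old sets covers the new
-- range ⌈v/3⌉ + 1, …, ⌊2v/3⌋ + 2.

module Submission where

open import Defs
open import Data.Bool using (true; false)
open import Data.Fin using (Fin; zero; suc; _≟_; _↑ˡ_; punchIn; punchOut; toℕ; fromℕ<; #_)
open import Data.Fin.Properties
  using (all?; any?; ↑ˡ-injective; punchIn-injective; punchInᵢ≢i; punchIn-punchOut; toℕ-fromℕ<)
open import Data.Fin.Subset using (Subset; _∈_; _∉_; ∣_∣)
open import Data.Fin.Subset.Properties using (_∈?_)
open import Data.List using (List; []; _∷_; length; filter; allFin; map; tabulate)
open import Data.List.Properties using (length-tabulate; length-map)
import Data.List.Membership.Propositional as List
open import Data.List.Membership.Propositional.Properties
  using (∈-filter⁺; ∈-filter⁻; ∈-allFin; ∈-map⁺; ∈-map⁻; ∈-tabulate⁺; ∈-tabulate⁻)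
open import Data.List.Membership.Propositional.Properties.WithK using (unique∧set⇒bag)
open import Data.List.Relation.Binary.BagAndSetEquality using (∼bag⇒↭)
open import Data.List.Relation.Binary.Permutation.Propositional.Properties using (↭-length)
open import Data.List.Relation.Unary.All using (_∷_)
open import Data.List.Relation.Unary.Any using (here; there)
open import Data.List.Relation.Unary.Unique.Propositional using (Unique; _∷_)
import Data.List.Relation.Unary.Unique.Propositional.Properties as Unique
open import Data.Nat using (ℕ; zero; suc; _+_; _*_; _/_; _≤_; _<_; z≤n; s≤s; _≤?_; _<?_; _<ᵇ_)
import Data.Nat as ℕ
open import Data.Nat.DivMod using (m/n≡1+[m∸n]/n)
open import Data.Nat.Properties
  using (*-distribˡ-+; ≤-trans; ≤-refl; ≤-pred; n≤1+n; ≤-antisym; ≰⇒>; m≤n⇒∃[o]m+o≡n)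
open import Data.Product using (∃-syntax; _×_; _,_; proj₁; proj₂)
open import Data.Sum using (_⊎_; inj₁; inj₂)
open import Data.Vec using (Vec; []; _∷_; here; there; lookup)
import Data.Vec as Vec
open import Data.Vec.Functional using (Vector; updateAt)
open import Data.Vec.Functional.Properties using (updateAt-updates; updateAt-minimal)
open import Function using (_∘_; const)
open import Function.Bundles using (mk⇔)
open import Function.Definitions using (Injective)
open import Relation.Binary.Definitions using (DecidableEquality)
open import Relation.Binary.PropositionalEquality using (_≡_; _≢_; refl; sym; trans; cong; subst)
open import Relation.Nullary using (¬_; Dec; yes; no; contradiction)
open import Relation.Nullary.Decidable using (True; map′; toWitness; _×-dec_; _⊎-dec_; _→-dec_; ¬?)
open import Relation.Unary using (Pred; Decidable)

length≤1⇒subsingleton : ∀ {a} {A : Set a} {xs : List A} → length xs ≤ 1 →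
  ∀ {x y} → x List.∈ xs → y List.∈ xs → x ≡ y
length≤1⇒subsingleton {xs = _ ∷ []} _ (here refl) (here refl) = refl
length≤1⇒subsingleton {xs = _ ∷ _ ∷ _} (s≤s ())

unique∧subsingleton⇒length≤1 : ∀ {a} {A : Set a} {xs : List A} → Unique xs →
  (∀ {x y} → x List.∈ xs → y List.∈ xs → x ≡ y) → length xs ≤ 1
unique∧subsingleton⇒length≤1 {xs = []} _ _ = z≤n
unique∧subsingleton⇒length≤1 {xs = _ ∷ []} _ _ = s≤s z≤n
unique∧subsingleton⇒length≤1 {xs = _ ∷ _ ∷ _} ((x≢y ∷ _) ∷ _) subsingleton =
  contradiction (subsingleton (here refl) (there (here refl))) x≢y

module _ {p} {n : ℕ} {P : Pred (Fin n) p} (P? : Decidable P) where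

  length-filter-allFin : ∀ {ys} → Unique ys → (∀ {x} → P x → x List.∈ ys) → (∀ {x} → x List.∈ ys → P x) →
    length (filter P? (allFin n)) ≡ length ys
  length-filter-allFin unique-ys to from = ↭-length (∼bag⇒↭ (unique∧set⇒bag
    (Unique.filter⁺ P? (Unique.allFin⁺ n)) unique-ys
    (mk⇔ (λ x∈ → to (proj₂ (∈-filter⁻ P? {xs = allFin n} x∈)))
         (λ x∈ → ∈-filter⁺ P? (∈-allFin _) (from x∈)))))

  length-filter-allFin≤1 : (∀ {x y} → P x → P y → x ≡ y) → length (filter P? (allFin n)) ≤ 1
  length-filter-allFin≤1 subsingleton = unique∧subsingleton⇒length≤1
    (Unique.filter⁺ P? (Unique.allFin⁺ n))
    (λ x∈ y∈ → subsingleton (proj₂ (∈-filter⁻ P? {xs = allFin n} x∈))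
                            (proj₂ (∈-filter⁻ P? {xs = allFin n} y∈)))

  ∈-filter-allFin : ∀ {x} → P x → x List.∈ filter P? (allFin n)
  ∈-filter-allFin = ∈-filter⁺ P? (∈-allFin _)

  ∈-filter-allFin⁻ : ∀ {x} → x List.∈ filter P? (allFin n) → P x
  ∈-filter-allFin⁻ x∈ = proj₂ (∈-filter⁻ P? {xs = allFin n} x∈)

module _ {v : ℕ} (C : Structure v) where

  Adjacent : Fin v → Fin v → Set
  Adjacent p q = ∃[ b ] ((p ∈B block C) b × (q ∈B block C) b)

  Reach-trans : ∀ {p q r} → Reach C p q → Reach C q r → Reach C p r
  Reach-trans here q↝r = q↝r
  Reach-trans (step b p∈b q∈b p↝q) q↝r = step b p∈b q∈b (Reach-trans p↝q q↝r)

  Reach-sym : ∀ {p q} → Reach C p q → Reach C q p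
  Reach-sym here = here
  Reach-sym (step b p∈b q∈b q↝r) = Reach-trans (Reach-sym q↝r) (step b q∈b p∈b here)

  connected-via : (root : Fin v) → (∀ p → Reach C p root) → Connected C
  connected-via root reach p q = Reach-trans (reach p) (Reach-sym (reach q))

  connected-by-rank : (root : Fin v) (rank : Fin v → ℕ) →
    (∀ p → p ≡ root ⊎ ∃[ q ] (rank q < rank p × Adjacent p q)) → Connected C
  connected-by-rank root rank descend = connected-via root λ p → go p (suc (rank p)) ≤-refl
    where
    go : ∀ p k → rank p < k → Reach C p root
    go p (suc k) rank<k with descend p
    ... | inj₁ refl = here
    ... | inj₂ (q , q<p , b , p∈b , q∈b) = step b p∈b q∈b (go q k (≤-trans q<p (≤-pred rank<k)))

  linear : IsConfiguration C → ∀ {p q} → p ≢ q → ∀ {b b'} →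
    (p ∈B block C) b → (q ∈B block C) b → (p ∈B block C) b' → (q ∈B block C) b' → b ≡ b'
  linear isC p≢q p∈b q∈b p∈b' q∈b' = length≤1⇒subsingleton (IsConfiguration.atMostOne isC _ _ p≢q)
    (∈-filter-allFin both? (p∈b , q∈b)) (∈-filter-allFin both? (p∈b' , q∈b'))
    where both? = λ b → incident? C _ b ×-dec incident? C _ b

  isConfiguration? : Dec (IsConfiguration C)
  isConfiguration? = map′
    (λ (d , t , o) → record { blockDistinct = λ b → d b _ _ ; threeBlocks = t ; atMostOne = o })
    (λ isC → let open IsConfiguration isC in (λ b _ _ → blockDistinct b) , threeBlocks , atMostOne)
    ((all? λ b → all? λ i → all? λ j → (block C b i ≟ block C b j) →-dec (i ≟ j)) ×-dec
     (all? λ p → length (blocksThrough C p) ℕ.≟ 3) ×-dec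
     (all? λ p → all? λ q → ¬? (p ≟ q) →-dec (length (blocksThrough₂ C p q) ≤? 1)))

  adjacent? : ∀ p q → Dec (Adjacent p q)
  adjacent? p q = any? λ b → incident? C p b ×-dec incident? C q b

-- Labellings and the invariant of the construction

pattern 0F = zero
pattern 1F = suc zero
pattern 2F = suc (suc zero)

data Label : Set where
  forcedIn free forcedOut : Label

Separates : ∀ {v} → (Fin v → Label) → Subset v → Set
Separates label Q = (∀ p → label p ≡ forcedIn → p ∈ Q) × (∀ p → label p ≡ forcedOut → p ∉ Q)

Bicoloured : ∀ {v} → (Fin v → Label) → (Fin 3 → Fin v) → Set
Bicoloured label points = (∃[ i ] label (points i) ≡ forcedIn) × (∃[ i ] label (points i) ≡ forcedOut)

ForcedEnds : ∀ {v} → (Fin v → Label) → (Fin 3 → Fin v) → Set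
ForcedEnds label points = label (points 0F) ≡ forcedIn × label (points 2F) ≡ forcedOut

forcedEnds⇒bicoloured : ∀ {v} (label : Fin v → Label) points →
  ForcedEnds label points → Bicoloured label points
forcedEnds⇒bicoloured _ _ (in₀ , out₂) = (0F , in₀) , (2F , out₂)

AllBlockingSizes : ∀ {v} → Structure v → Set
AllBlockingSizes {v} C = (q : ℕ) → ⌈ v /3⌉ ≤ q → q ≤ ⌊2 v /3⌋ → ∃[ Q ] (IsBlockingSet C Q × ∣ Q ∣ ≡ q)

separates⇒blocking : ∀ {v} (C : Structure v) {label} → (∀ b → Bicoloured label (block C b)) →
  ∀ {Q} → Separates label Q → IsBlockingSet C Q
separates⇒blocking C bicoloured (forced-in , forced-out) b
  with (i , i-in) , (o , o-out) ← bicoloured b = (i , forced-in _ i-in) , (o , forced-out _ o-out)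

-- The anchors' end labels make the modified anchors and the new blocks of the extension bicoloured.
record Extendable (v : ℕ) : Set where
  field
    structure        : Structure v
    isConfiguration  : IsConfiguration structure
    connected        : Connected structure
    label            : Fin v → Label
    bicoloured       : ∀ b → Bicoloured label (block structure b)
    anchor           : Fin 3 → Fin v
    anchor-ends      : ∀ j → ForcedEnds label (block structure (anchor j))
    anchors-disjoint : ∀ j j' i i' → block structure (anchor j) i ≡ block structure (anchor j') i' → j ≡ j'
    range-nonempty   : ⌈ v /3⌉ ≤ ⌊2 v /3⌋
    separated        : ∀ q → ⌈ v /3⌉ ≤ q → q ≤ ⌊2 v /3⌋ → ∃[ Q ] (Separates label Q × ∣ Q ∣ ≡ q)

  allBlockingSizes : AllBlockingSizes structure
  allBlockingSizes q lo hi with Q , separates , ∣Q∣≡q ← separated q lo hi =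
    Q , separates⇒blocking structure bicoloured separates , ∣Q∣≡q

-- The extension step

updateAt-const : ∀ {n} {A : Set} (xs : Vector A n) j y i →
  (i ≡ j × updateAt xs j (const y) i ≡ y) ⊎ (i ≢ j × updateAt xs j (const y) i ≡ xs i)
updateAt-const xs j y i with i ≟ j
... | yes refl = inj₁ (refl , updateAt-updates i xs)
... | no i≢j = inj₂ (i≢j , updateAt-minimal i j xs i≢j)

updateAt-const-injective : ∀ {n} {A : Set} {xs : Vector A n} → Injective _≡_ _≡_ xs →
  ∀ {y} → (∀ i → xs i ≢ y) → ∀ j → Injective _≡_ _≡_ (updateAt xs j (const y))
updateAt-const-injective {xs = xs} xs-injective {y} y∉xs j {i} {i'} eq
  with updateAt-const xs j y i | updateAt-const xs j y i'
... | inj₁ (i≡j , _)   | inj₁ (i'≡j , _)  = trans i≡j (sym i'≡j)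
... | inj₁ (_ , eq₁)   | inj₂ (_ , eq₂)   = contradiction (trans (sym eq₂) (trans (sym eq) eq₁)) (y∉xs i')
... | inj₂ (_ , eq₁)   | inj₁ (_ , eq₂)   = contradiction (trans (sym eq₁) (trans eq eq₂)) (y∉xs i)
... | inj₂ (_ , eq₁)   | inj₂ (_ , eq₂)   = xs-injective (trans (sym eq₁) (trans eq eq₂))

[3+m]/3≡1+m/3 : ∀ m → (3 + m) / 3 ≡ suc (m / 3)
[3+m]/3≡1+m/3 m = m/n≡1+[m∸n]/n {3 + m} (s≤s (s≤s (s≤s z≤n)))

⌈3+v/3⌉≡1+⌈v/3⌉ : ∀ v → ⌈ 3 + v /3⌉ ≡ suc ⌈ v /3⌉
⌈3+v/3⌉≡1+⌈v/3⌉ v = [3+m]/3≡1+m/3 (v + 2)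

⌊2[3+v]/3⌋≡2+⌊2v/3⌋ : ∀ v → ⌊2 (3 + v) /3⌋ ≡ 2 + ⌊2 v /3⌋
⌊2[3+v]/3⌋≡2+⌊2v/3⌋ v = trans (cong (_/ 3) (*-distribˡ-+ 2 3 v))
  (trans ([3+m]/3≡1+m/3 (3 + 2 * v)) (cong suc ([3+m]/3≡1+m/3 (2 * v))))

third-unique : ∀ (k k' j j' : Fin 3) → k ≢ k' → j ≢ k → j ≢ k' → j' ≢ k → j' ≢ k' → j ≡ j'
third-unique = toWitness {a? = all? λ k → all? λ k' → all? λ j → all? λ j' →
  ¬? (k ≟ k') →-dec ¬? (j ≟ k) →-dec ¬? (j ≟ k') →-dec ¬? (j' ≟ k) →-dec ¬? (j' ≟ k') →-dec (j ≟ j')} _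

module Extension {v : ℕ} (E : Extendable v) where
  open Extendable E

  blk : Fin v → Fin 3 → Fin v
  blk = block structure

  old : Fin v → Fin (3 + v)
  old o = suc (suc (suc o))

  new : Fin 3 → Fin (3 + v)
  new j = j ↑ˡ v

  new-injective : ∀ {j j'} → new j ≡ new j' → j ≡ j'
  new-injective = ↑ˡ-injective v _ _

  old-injective : ∀ {o o' : Fin v} → old o ≡ old o' → o ≡ o'
  old-injective refl = refl

  old≢new : ∀ {o j} → old o ≢ new j
  old≢new {j = 0F} ()
  old≢new {j = 1F} ()
  old≢new {j = 2F} ()

  data NewOrOld : Fin (3 + v) → Set where
    isNew : ∀ j → NewOrOld (new j)
    isOld : ∀ o → NewOrOld (old o)

  newOrOld : ∀ p → NewOrOld p
  newOrOld 0F = isNew 0F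
  newOrOld 1F = isNew 1F
  newOrOld 2F = isNew 2F
  newOrOld (suc (suc (suc o))) = isOld o

  caseNewOld : {A : Set} → (Fin 3 → A) → (Fin v → A) → Fin (3 + v) → A
  caseNewOld f g 0F = f 0F
  caseNewOld f g 1F = f 1F
  caseNewOld f g 2F = f 2F
  caseNewOld f g (suc (suc (suc o))) = g o

  caseNewOld-new : ∀ {A : Set} (f : Fin 3 → A) g j → caseNewOld f g (new j) ≡ f j
  caseNewOld-new f g 0F = refl
  caseNewOld-new f g 1F = refl
  caseNewOld-new f g 2F = refl

  anchor-injective : ∀ {j j'} → anchor j ≡ anchor j' → j ≡ j'
  anchor-injective {j} {j'} eq = anchors-disjoint j j' 0F 0F (cong (λ b → blk b 0F) eq)

  -- The pivot x_j leaves anchor j for newBlock j = {x_j} ∪ {n_i | i ≠ j}, written with x_j in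
  -- position j; n_j takes its place in reroutedAnchor j.
  pivot : Fin 3 → Fin v
  pivot j = blk (anchor j) j

  pivot-∈-anchor : ∀ j → (pivot j ∈B blk) (anchor j)
  pivot-∈-anchor j = j , refl

  pivot-injective : ∀ {j j'} → pivot j ≡ pivot j' → j ≡ j'
  pivot-injective {j} {j'} = anchors-disjoint j j' j j'

  pivot-anchor : ∀ {o k j} → (o ∈B blk) (anchor k) → o ≡ pivot j → k ≡ j
  pivot-anchor {k = k} {j} (i , refl) = anchors-disjoint k j i j

  newBlock : Fin 3 → Fin 3 → Fin (3 + v)
  newBlock j = updateAt new j (const (old (pivot j)))

  reroutedAnchor : Fin 3 → Fin 3 → Fin (3 + v)
  reroutedAnchor j = updateAt (old ∘ blk (anchor j)) j (const (new j))

  anchor? : ∀ b → Dec (∃[ j ] anchor j ≡ b)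
  anchor? b = any? λ j → anchor j ≟ b

  oldBlock : ∀ b → Dec (∃[ j ] anchor j ≡ b) → Fin 3 → Fin (3 + v)
  oldBlock b (yes (j , _)) = reroutedAnchor j
  oldBlock b (no _) = old ∘ blk b

  block′ : Fin (3 + v) → Fin 3 → Fin (3 + v)
  block′ = caseNewOld newBlock (λ b → oldBlock b (anchor? b))

  C′ : Structure (3 + v)
  C′ = record { block = block′ }

  _∈′_ : Fin (3 + v) → Fin (3 + v) → Set
  p ∈′ b = (p ∈B block′) b

  block′-new : ∀ j → block′ (new j) ≡ newBlock j
  block′-new = caseNewOld-new newBlock _

  ∈-new⁻ : ∀ {p j} → p ∈′ new j → ∃[ i ] newBlock j i ≡ p
  ∈-new⁻ {p} {j} = subst (λ blk′ → ∃[ i ] blk′ i ≡ p) (block′-new j)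

  ∈-new⁺ : ∀ {p j} → ∃[ i ] newBlock j i ≡ p → p ∈′ new j
  ∈-new⁺ {p} {j} = subst (λ blk′ → ∃[ i ] blk′ i ≡ p) (sym (block′-new j))

  block′-anchor : ∀ j → block′ (old (anchor j)) ≡ reroutedAnchor j
  block′-anchor j with anchor? (anchor j)
  ... | yes (j' , eq) = cong reroutedAnchor (anchor-injective eq)
  ... | no ¬anchor = contradiction (j , refl) ¬anchor

  ∈-anchor⁺ : ∀ {p j} → ∃[ i ] reroutedAnchor j i ≡ p → p ∈′ old (anchor j)
  ∈-anchor⁺ {p} {j} = subst (λ blk′ → ∃[ i ] blk′ i ≡ p) (sym (block′-anchor j))

  new-∈-new⁻ : ∀ {k j} → new k ∈′ new j → k ≢ j
  new-∈-new⁻ {k} {j} k∈j with i , eq ← ∈-new⁻ {j = j} k∈j | updateAt-const new j (old (pivot j)) i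
  ... | inj₁ (_ , eq′) = contradiction (trans (sym eq′) eq) old≢new
  ... | inj₂ (i≢j , eq′) = λ k≡j → i≢j (trans (new-injective (trans (sym eq′) eq)) k≡j)

  new-∈-new⁺ : ∀ {k j} → k ≢ j → new k ∈′ new j
  new-∈-new⁺ {k} {j} k≢j = ∈-new⁺ {j = j} (k , updateAt-minimal k j new k≢j)

  old-∈-new⁻ : ∀ {o j} → old o ∈′ new j → o ≡ pivot j
  old-∈-new⁻ {o} {j} o∈j with i , eq ← ∈-new⁻ {j = j} o∈j | updateAt-const new j (old (pivot j)) i
  ... | inj₁ (_ , eq′) = sym (old-injective (trans (sym eq′) eq))
  ... | inj₂ (_ , eq′) = contradiction (trans (sym eq) eq′) old≢new

  pivot-∈-new : ∀ j → old (pivot j) ∈′ new j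
  pivot-∈-new j = ∈-new⁺ {j = j} (j , updateAt-updates j new)

  new-∈-old⁻ : ∀ {k b} → new k ∈′ old b → b ≡ anchor k
  new-∈-old⁻ {k} {b} (i , eq) with anchor? b
  ... | no _ = contradiction eq old≢new
  ... | yes (j , refl) with updateAt-const (old ∘ blk (anchor j)) j (new j) i
  ...   | inj₁ (_ , eq′) = cong anchor (new-injective (trans (sym eq′) eq))
  ...   | inj₂ (_ , eq′) = contradiction (trans (sym eq′) eq) old≢new

  new-∈-anchor : ∀ k → new k ∈′ old (anchor k)
  new-∈-anchor k = ∈-anchor⁺ (k , updateAt-updates k (old ∘ blk (anchor k)))

  Moved : Fin v → Fin v → Set
  Moved o b = ∃[ j ] (b ≡ anchor j × o ≡ pivot j)

  old-∈-old⁻ : ∀ {o b} → old o ∈′ old b → (o ∈B blk) b × ¬ Moved o b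
  old-∈-old⁻ {o} {b} (i , eq) with anchor? b
  ... | no ¬anchor = (i , old-injective eq) , λ (j , b≡ , _) → ¬anchor (j , sym b≡)
  ... | yes (j , refl) with updateAt-const (old ∘ blk (anchor j)) j (new j) i
  ...   | inj₁ (_ , eq′) = contradiction (trans (sym eq) eq′) old≢new
  ...   | inj₂ (i≢j , eq′) = (i , o∈) , unmoved
    where
    o∈ : blk (anchor j) i ≡ o
    o∈ = old-injective (trans (sym eq′) eq)
    unmoved : ¬ Moved o (anchor j)
    unmoved (j' , b≡ , o≡) with anchor-injective b≡
    ... | refl = i≢j (block-distinct (trans o∈ o≡))
      where block-distinct = IsConfiguration.blockDistinct isConfiguration (anchor j)

  old-∈-old⁺ : ∀ {o b} → (o ∈B blk) b → ¬ Moved o b → old o ∈′ old b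
  old-∈-old⁺ {o} {b} (i , eq) unmoved with anchor? b
  ... | no _ = i , cong old eq
  ... | yes (j , refl) = i , trans (updateAt-minimal i j _ i≢j) (cong old eq)
    where
    i≢j : i ≢ j
    i≢j refl = unmoved (j , refl , sym eq)

  blockDistinct′ : ∀ b → Injective _≡_ _≡_ (block′ b)
  blockDistinct′ b with newOrOld b
  ... | isNew j rewrite block′-new j =
    updateAt-const-injective (↑ˡ-injective v _ _) (λ _ → old≢new ∘ sym) j
  ... | isOld b with anchor? b
  ...   | yes (j , refl) = updateAt-const-injective
            (IsConfiguration.blockDistinct isConfiguration (anchor j) ∘ old-injective) (λ _ → old≢new) j
  ...   | no _ = IsConfiguration.blockDistinct isConfiguration b ∘ old-injective

  newPencil : Fin 3 → Fin 3 → Fin (3 + v)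
  newPencil k 0F = old (anchor k)
  newPencil k (suc i) = new (punchIn k i)

  newPencil-injective : ∀ k → Injective _≡_ _≡_ (newPencil k)
  newPencil-injective k {0F} {0F} _ = refl
  newPencil-injective k {0F} {suc _} eq = contradiction eq old≢new
  newPencil-injective k {suc _} {0F} eq = contradiction (sym eq) old≢new
  newPencil-injective k {suc i} {suc i'} eq = cong suc (punchIn-injective k i i' (new-injective eq))

  newPencil-incident : ∀ k {X} → X List.∈ tabulate (newPencil k) → new k ∈′ X
  newPencil-incident k X∈ with ∈-tabulate⁻ {f = newPencil k} X∈
  ... | 0F , refl = new-∈-anchor k
  ... | suc i , refl = new-∈-new⁺ (punchInᵢ≢i k i ∘ sym)

  newPencil-complete : ∀ {k} X → new k ∈′ X → X List.∈ tabulate (newPencil k)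
  newPencil-complete {k} X k∈X with newOrOld X
  ... | isNew j = subst (List._∈ tabulate (newPencil k)) (cong new (punchIn-punchOut (new-∈-new⁻ {j = j} k∈X)))
                    (∈-tabulate⁺ {f = newPencil k} (suc (punchOut (new-∈-new⁻ {j = j} k∈X))))
  ... | isOld b rewrite new-∈-old⁻ k∈X = ∈-tabulate⁺ {f = newPencil k} 0F

  moved? : ∀ o b → Dec (Moved o b)
  moved? o b = any? λ j → (b ≟ anchor j) ×-dec (o ≟ pivot j)

  reroute : Fin v → Fin v → Fin (3 + v)
  reroute o b with moved? o b
  ... | yes (j , _) = new j
  ... | no _ = old b

  reroute-injective : ∀ o → Injective _≡_ _≡_ (reroute o)
  reroute-injective o {b} {b'} eq with moved? o b | moved? o b'
  ... | yes (j , b≡ , _) | yes (j' , b'≡ , _) = trans b≡ (trans (cong anchor (new-injective eq)) (sym b'≡))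
  ... | yes _ | no _ = contradiction (sym eq) old≢new
  ... | no _ | yes _ = contradiction eq old≢new
  ... | no _ | no _ = old-injective eq

  reroute-incident : ∀ {o b} → (o ∈B blk) b → old o ∈′ reroute o b
  reroute-incident {o} {b} o∈b with moved? o b
  ... | yes (j , refl , refl) = pivot-∈-new j
  ... | no unmoved = old-∈-old⁺ o∈b unmoved

  reroute-pivot : ∀ j → reroute (pivot j) (anchor j) ≡ new j
  reroute-pivot j with moved? (pivot j) (anchor j)
  ... | yes (j' , b≡ , _) = cong new (anchor-injective (sym b≡))
  ... | no unmoved = contradiction (j , refl , refl) unmoved

  reroute-unmoved : ∀ {o b} → ¬ Moved o b → reroute o b ≡ old b
  reroute-unmoved {o} {b} unmoved with moved? o b
  ... | yes moved = contradiction moved unmoved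
  ... | no _ = refl

  oldPencil : Fin v → List (Fin (3 + v))
  oldPencil o = map (reroute o) (blocksThrough structure o)

  oldPencil-complete : ∀ {o} X → old o ∈′ X → X List.∈ oldPencil o
  oldPencil-complete {o} X o∈X with newOrOld X
  ... | isNew j with refl ← old-∈-new⁻ {j = j} o∈X =
    subst (List._∈ oldPencil o) (reroute-pivot j)
      (∈-map⁺ (reroute o) (∈-filter-allFin (incident? structure o) (pivot-∈-anchor j)))
  ... | isOld b with o∈b , unmoved ← old-∈-old⁻ o∈X =
    subst (List._∈ oldPencil o) (reroute-unmoved unmoved)
      (∈-map⁺ (reroute o) (∈-filter-allFin (incident? structure o) o∈b))

  oldPencil-incident : ∀ {o X} → X List.∈ oldPencil o → old o ∈′ X
  oldPencil-incident {o} X∈ with b , b∈ , refl ← ∈-map⁻ (reroute o) X∈ =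
    reroute-incident (∈-filter-allFin⁻ (incident? structure o) b∈)

  threeBlocks′ : ∀ p → length (blocksThrough C′ p) ≡ 3
  threeBlocks′ p with newOrOld p
  ... | isNew k = trans
    (length-filter-allFin (incident? C′ (new k)) (Unique.tabulate⁺ {f = newPencil k} (newPencil-injective k))
      (newPencil-complete _) (newPencil-incident k))
    (length-tabulate (newPencil k))
  ... | isOld o = trans
    (length-filter-allFin (incident? C′ (old o))
      (Unique.map⁺ (reroute-injective o) (Unique.filter⁺ (incident? structure o) (Unique.allFin⁺ v)))
      (oldPencil-complete _) (oldPencil-incident {o}))
    (trans (length-map (reroute o) (blocksThrough structure o)) (IsConfiguration.threeBlocks isConfiguration o))

  common-new-new : ∀ {k k' X} → k ≢ k' → new k ∈′ X → new k' ∈′ X → ∃[ j ] (X ≡ new j × j ≢ k × j ≢ k')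
  common-new-new {k} {k'} {X} k≢k' k∈X k'∈X with newOrOld X
  ... | isNew j = j , refl , new-∈-new⁻ {j = j} k∈X ∘ sym , new-∈-new⁻ {j = j} k'∈X ∘ sym
  ... | isOld b = contradiction (anchor-injective (trans (sym (new-∈-old⁻ k∈X)) (new-∈-old⁻ k'∈X))) k≢k'

  common-old-old : ∀ {o o' X} → o ≢ o' → old o ∈′ X → old o' ∈′ X →
    ∃[ b ] (X ≡ old b × (o ∈B blk) b × (o' ∈B blk) b)
  common-old-old {o} {o'} {X} o≢o' o∈X o'∈X with newOrOld X
  ... | isNew j = contradiction (trans (old-∈-new⁻ {j = j} o∈X) (sym (old-∈-new⁻ {j = j} o'∈X))) o≢o'
  ... | isOld b = b , refl , proj₁ (old-∈-old⁻ o∈X) , proj₁ (old-∈-old⁻ o'∈X)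

  common-new-old : ∀ {k o X} → new k ∈′ X → old o ∈′ X →
    (X ≡ old (anchor k) × (o ∈B blk) (anchor k)) ⊎ ∃[ j ] (X ≡ new j × o ≡ pivot j × k ≢ j)
  common-new-old {k} {o} {X} k∈X o∈X with newOrOld X
  ... | isNew j = inj₂ (j , refl , old-∈-new⁻ {j = j} o∈X , new-∈-new⁻ {j = j} k∈X)
  ... | isOld b with refl ← new-∈-old⁻ k∈X = inj₁ (refl , proj₁ (old-∈-old⁻ o∈X))

  linear-new-old : ∀ {k o X Y} → new k ∈′ X → old o ∈′ X → new k ∈′ Y → old o ∈′ Y → X ≡ Y
  linear-new-old {X = X} {Y} k∈X o∈X k∈Y o∈Y
    with common-new-old {X = X} k∈X o∈X | common-new-old {X = Y} k∈Y o∈Y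
  ... | inj₁ (refl , _) | inj₁ (refl , _) = refl
  ... | inj₂ (j , refl , o≡ , _) | inj₂ (j' , refl , o≡′ , _) = cong new (pivot-injective (trans (sym o≡) o≡′))
  ... | inj₁ (_ , o∈k) | inj₂ (_ , _ , o≡ , k≢j) = contradiction (pivot-anchor o∈k o≡) k≢j
  ... | inj₂ (_ , _ , o≡ , k≢j) | inj₁ (_ , o∈k) = contradiction (pivot-anchor o∈k o≡) k≢j

  linear′ : ∀ {p q} → p ≢ q → ∀ {X Y} → p ∈′ X → q ∈′ X → p ∈′ Y → q ∈′ Y → X ≡ Y
  linear′ {p} {q} p≢q {X} {Y} p∈X q∈X p∈Y q∈Y with newOrOld p | newOrOld q
  ... | isNew k | isOld o = linear-new-old p∈X q∈X p∈Y q∈Y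
  ... | isOld o | isNew k = linear-new-old q∈X p∈X q∈Y p∈Y
  ... | isNew k | isNew k'
    with j , refl , j≢k , j≢k' ← common-new-new {X = X} (p≢q ∘ cong new) p∈X q∈X
       | j' , refl , j'≢k , j'≢k' ← common-new-new {X = Y} (p≢q ∘ cong new) p∈Y q∈Y
    = cong new (third-unique k k' j j' (p≢q ∘ cong new) j≢k j≢k' j'≢k j'≢k')
  ... | isOld o | isOld o'
    with b , refl , o∈b , o'∈b ← common-old-old {X = X} (p≢q ∘ cong old) p∈X q∈X
       | b' , refl , o∈b' , o'∈b' ← common-old-old {X = Y} (p≢q ∘ cong old) p∈Y q∈Y
    = cong old (linear structure isConfiguration (p≢q ∘ cong old) o∈b o'∈b o∈b' o'∈b')

  atMostOne′ : ∀ p q → p ≢ q → length (blocksThrough₂ C′ p q) ≤ 1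
  atMostOne′ p q p≢q = length-filter-allFin≤1 (λ b → incident? C′ p b ×-dec incident? C′ q b)
    λ (p∈X , q∈X) (p∈Y , q∈Y) → linear′ p≢q p∈X q∈X p∈Y q∈Y

  isConfiguration′ : IsConfiguration C′
  isConfiguration′ = record
    { blockDistinct = blockDistinct′
    ; threeBlocks   = threeBlocks′
    ; atMostOne     = atMostOne′
    }

  root : Fin (3 + v)
  root = new 0F

  new-reaches-root : ∀ k → Reach C′ (new k) root
  new-reaches-root 0F = here
  new-reaches-root 1F = step (new 2F) (1F , refl) (0F , refl) here
  new-reaches-root 2F = step (new 1F) (2F , refl) (0F , refl) here

  anchor-member-reaches-root : ∀ {o j} → (o ∈B blk) (anchor j) → Reach C′ (old o) root
  anchor-member-reaches-root {j = j} (i , refl) with i ≟ j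
  ... | yes refl = step (new j) (pivot-∈-new j) (new-∈-new⁺ (punchInᵢ≢i j 0F)) (new-reaches-root _)
  ... | no i≢j = step (old (anchor j)) (∈-anchor⁺ (i , updateAt-minimal i j _ i≢j)) (new-∈-anchor j)
                   (new-reaches-root j)

  old-reach : ∀ {o o'} → Reach structure o o' → Reach C′ (old o) (old o')
  old-reach here = here
  old-reach (step b o∈b o₁∈b o₁↝o') with anchor? b
  ... | yes (j , refl) = Reach-trans C′ (anchor-member-reaches-root o∈b)
          (Reach-trans C′ (Reach-sym C′ (anchor-member-reaches-root o₁∈b)) (old-reach o₁↝o'))
  ... | no ¬anchor = step (old b) (old-∈-old⁺ o∈b unmoved) (old-∈-old⁺ o₁∈b unmoved) (old-reach o₁↝o')
    where
    unmoved : ∀ {o} → ¬ Moved o b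
    unmoved (j , b≡ , _) = ¬anchor (j , sym b≡)

  connected′ : Connected C′
  connected′ = connected-via C′ root λ p → case p
    where
    case : ∀ p → Reach C′ p root
    case p with newOrOld p
    ... | isNew k = new-reaches-root k
    ... | isOld o = Reach-trans C′ (old-reach (connected o (pivot 0F)))
                      (anchor-member-reaches-root (pivot-∈-anchor 0F))

  newLabel : Fin 3 → Label
  newLabel 0F = forcedIn
  newLabel 1F = free
  newLabel 2F = forcedOut

  label′ : Fin (3 + v) → Label
  label′ = caseNewOld newLabel label

  newBlock-ends : ∀ j → ForcedEnds label′ (newBlock j)
  newBlock-ends 0F = proj₁ (anchor-ends 0F) , refl
  newBlock-ends 1F = refl , refl
  newBlock-ends 2F = refl , proj₂ (anchor-ends 2F)

  reroutedAnchor-ends : ∀ j → ForcedEnds label′ (reroutedAnchor j)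
  reroutedAnchor-ends 0F = refl , proj₂ (anchor-ends 0F)
  reroutedAnchor-ends 1F = proj₁ (anchor-ends 1F) , proj₂ (anchor-ends 1F)
  reroutedAnchor-ends 2F = proj₁ (anchor-ends 2F) , refl

  bicoloured′ : ∀ b → Bicoloured label′ (block′ b)
  bicoloured′ b with newOrOld b
  ... | isNew j rewrite block′-new j = forcedEnds⇒bicoloured label′ (newBlock j) (newBlock-ends j)
  ... | isOld b with anchor? b
  ...   | yes (j , refl) = forcedEnds⇒bicoloured label′ (reroutedAnchor j) (reroutedAnchor-ends j)
  ...   | no _ = bicoloured b

  anchor′ : Fin 3 → Fin (3 + v)
  anchor′ = old ∘ anchor

  anchor′-ends : ∀ j → ForcedEnds label′ (block′ (anchor′ j))
  anchor′-ends j rewrite block′-anchor j = reroutedAnchor-ends j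

  anchors′-disjoint : ∀ j j' i i' → block′ (anchor′ j) i ≡ block′ (anchor′ j') i' → j ≡ j'
  anchors′-disjoint j j' i i' eq rewrite block′-anchor j | block′-anchor j'
    with updateAt-const (old ∘ blk (anchor j)) j (new j) i | updateAt-const (old ∘ blk (anchor j')) j' (new j') i'
  ... | inj₁ (_ , eq₁) | inj₁ (_ , eq₂) = new-injective (trans (sym eq₁) (trans eq eq₂))
  ... | inj₁ (_ , eq₁) | inj₂ (_ , eq₂) = contradiction (trans (sym eq₂) (trans (sym eq) eq₁)) old≢new
  ... | inj₂ (_ , eq₁) | inj₁ (_ , eq₂) = contradiction (trans (sym eq₁) (trans eq eq₂)) old≢new
  ... | inj₂ (_ , eq₁) | inj₂ (_ , eq₂) = anchors-disjoint j j' i i' (old-injective (trans (sym eq₁) (trans eq eq₂)))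

  range-nonempty′ : ⌈ 3 + v /3⌉ ≤ ⌊2 (3 + v) /3⌋
  range-nonempty′ rewrite ⌈3+v/3⌉≡1+⌈v/3⌉ v | ⌊2[3+v]/3⌋≡2+⌊2v/3⌋ v = s≤s (≤-trans range-nonempty (n≤1+n _))

  extend-separating : ∀ {Q} b → Separates label Q → Separates label′ (true ∷ b ∷ false ∷ Q)
  extend-separating {Q} b (forced-in , forced-out) = forced-in′ , forced-out′
    where
    forced-in′ : ∀ p → label′ p ≡ forcedIn → p ∈ (true ∷ b ∷ false ∷ Q)
    forced-in′ 0F _ = here
    forced-in′ (suc (suc (suc o))) in-o = there (there (there (forced-in o in-o)))
    forced-out′ : ∀ p → label′ p ≡ forcedOut → p ∉ (true ∷ b ∷ false ∷ Q)
    forced-out′ 2F _ (there (there ()))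
    forced-out′ (suc (suc (suc o))) out-o (there (there (there o∈Q))) = forced-out o out-o o∈Q

  separated′ : ∀ q → ⌈ 3 + v /3⌉ ≤ q → q ≤ ⌊2 (3 + v) /3⌋ → ∃[ Q ] (Separates label′ Q × ∣ Q ∣ ≡ q)
  separated′ q lo hi rewrite ⌈3+v/3⌉≡1+⌈v/3⌉ v | ⌊2[3+v]/3⌋≡2+⌊2v/3⌋ v with lo
  ... | s≤s {n = q₀} lo₀ with q₀ ≤? ⌊2 v /3⌋
  ...   | yes hi₀ with Q , separates , refl ← separated q₀ lo₀ hi₀ =
    true ∷ false ∷ false ∷ Q , extend-separating false separates , refl
  ...   | no ¬hi₀ with Q , separates , ∣Q∣≡top ← separated ⌊2 v /3⌋ range-nonempty ≤-refl =
    true ∷ true ∷ false ∷ Q , extend-separating true separates ,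
    cong suc (trans (cong suc ∣Q∣≡top) (≤-antisym (≰⇒> ¬hi₀) (≤-pred hi)))

  extended : Extendable (3 + v)
  extended = record
    { structure        = C′
    ; isConfiguration  = isConfiguration′
    ; connected        = connected′
    ; label            = label′
    ; bicoloured       = bicoloured′
    ; anchor           = anchor′
    ; anchor-ends      = anchor′-ends
    ; anchors-disjoint = anchors′-disjoint
    ; range-nonempty   = range-nonempty′
    ; separated        = separated′
    }

-- Base cases

_≟ₗ_ : DecidableEquality Label
forcedIn  ≟ₗ forcedIn  = yes refl
free      ≟ₗ free      = yes refl
forcedOut ≟ₗ forcedOut = yes refl
forcedIn  ≟ₗ free      = no λ ()
forcedIn  ≟ₗ forcedOut = no λ ()
free      ≟ₗ forcedIn  = no λ ()
free      ≟ₗ forcedOut = no λ ()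
forcedOut ≟ₗ forcedIn  = no λ ()
forcedOut ≟ₗ free      = no λ ()

module _ {v : ℕ} (label : Fin v → Label) where

  bicoloured? : ∀ points → Dec (Bicoloured label points)
  bicoloured? points = any? (λ i → label (points i) ≟ₗ forcedIn) ×-dec any? (λ i → label (points i) ≟ₗ forcedOut)

  forcedEnds? : ∀ points → Dec (ForcedEnds label points)
  forcedEnds? points = (label (points 0F) ≟ₗ forcedIn) ×-dec (label (points 2F) ≟ₗ forcedOut)

  separates? : ∀ Q → Dec (Separates label Q)
  separates? Q = (all? λ p → (label p ≟ₗ forcedIn) →-dec (p ∈? Q))
           ×-dec (all? λ p → (label p ≟ₗ forcedOut) →-dec ¬? (p ∈? Q))

module Tabulated {n : ℕ} (blocks : Vec (Vec (Fin (suc n)) 3) (suc n)) (labels : Vec Label (suc n))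
                 (anchors : Vec (Fin (suc n)) 3) (rank : Vec ℕ (suc n)) where

  C : Structure (suc n)
  C = record { block = λ b → lookup (lookup blocks b) }

  label : Fin (suc n) → Label
  label = lookup labels

  anchor : Fin 3 → Fin (suc n)
  anchor = lookup anchors

  -- The tables list the forcedIn points first and the forcedOut points last, so that initial
  -- segments separate.
  initialSegment : ℕ → Subset (suc n)
  initialSegment q = Vec.tabulate λ p → toℕ p <ᵇ q

  Descending : Set
  Descending = ∀ p → p ≡ zero ⊎ ∃[ q ] (lookup rank q < lookup rank p × Adjacent C p q)

  InitialSegmentsSeparate : Set
  InitialSegmentsSeparate = ∀ (q : Fin (suc ⌊2 suc n /3⌋)) → ⌈ suc n /3⌉ ≤ toℕ q →
    Separates label (initialSegment (toℕ q)) × ∣ initialSegment (toℕ q) ∣ ≡ toℕ q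

  Certificate : Set
  Certificate = IsConfiguration C × Descending × (∀ b → Bicoloured label (block C b))
    × (∀ j → ForcedEnds label (block C (anchor j)))
    × (∀ j j' i i' → block C (anchor j) i ≡ block C (anchor j') i' → j ≡ j')
    × ⌈ suc n /3⌉ ≤ ⌊2 suc n /3⌋
    × InitialSegmentsSeparate

  certificate? : Dec Certificate
  certificate? = isConfiguration? C
    ×-dec (all? λ p → (p ≟ zero) ⊎-dec any? λ q → (lookup rank q <? lookup rank p) ×-dec adjacent? C p q)
    ×-dec (all? λ b → bicoloured? label (block C b))
    ×-dec (all? λ j → forcedEnds? label (block C (anchor j)))
    ×-dec (all? λ j → all? λ j' → all? λ i → all? λ i' →
             (block C (anchor j) i ≟ block C (anchor j') i') →-dec (j ≟ j'))
    ×-dec (⌈ suc n /3⌉ ≤? ⌊2 suc n /3⌋)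
    ×-dec (all? λ q → (⌈ suc n /3⌉ ≤? toℕ q) →-dec
             (separates? label (initialSegment (toℕ q)) ×-dec (∣ initialSegment (toℕ q) ∣ ℕ.≟ toℕ q)))

  extendable : True certificate? → Extendable (suc n)
  extendable certified
    with isC , descending , bicoloured , ends , disjoint , nonempty , segments ← toWitness certified =
    record
      { structure        = C
      ; isConfiguration  = isC
      ; connected        = connected-by-rank C zero (lookup rank) descending
      ; label            = label
      ; bicoloured       = bicoloured
      ; anchor           = anchor
      ; anchor-ends      = ends
      ; anchors-disjoint = disjoint
      ; range-nonempty   = nonempty
      ; separated        = λ q lo hi → initialSegment q , segment q lo hi
      }
    where
    segment : ∀ q → ⌈ suc n /3⌉ ≤ q → q ≤ ⌊2 suc n /3⌋ →
      Separates label (initialSegment q) × ∣ initialSegment q ∣ ≡ q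
    segment q lo hi with segments (fromℕ< (s≤s hi))
    ... | segment-q rewrite toℕ-fromℕ< (s≤s hi) = segment-q lo

extendable₉ : Extendable 9
extendable₉ = Tabulated.extendable
  ((# 0 ∷ # 4 ∷ # 8 ∷ []) ∷ (# 1 ∷ # 4 ∷ # 7 ∷ []) ∷ (# 2 ∷ # 5 ∷ # 8 ∷ []) ∷ (# 1 ∷ # 3 ∷ # 8 ∷ []) ∷
   (# 2 ∷ # 4 ∷ # 6 ∷ []) ∷ (# 0 ∷ # 5 ∷ # 7 ∷ []) ∷ (# 0 ∷ # 3 ∷ # 6 ∷ []) ∷ (# 1 ∷ # 5 ∷ # 6 ∷ []) ∷
   (# 2 ∷ # 3 ∷ # 7 ∷ []) ∷ [])
  (forcedIn ∷ forcedIn ∷ forcedIn ∷ free ∷ free ∷ free ∷ forcedOut ∷ forcedOut ∷ forcedOut ∷ [])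
  (# 0 ∷ # 7 ∷ # 8 ∷ [])
  (0 ∷ 2 ∷ 2 ∷ 1 ∷ 1 ∷ 1 ∷ 1 ∷ 1 ∷ 1 ∷ [])
  _

extendable₁₀ : Extendable 10
extendable₁₀ = Tabulated.extendable
  ((# 0 ∷ # 4 ∷ # 8 ∷ []) ∷ (# 1 ∷ # 5 ∷ # 8 ∷ []) ∷ (# 2 ∷ # 6 ∷ # 7 ∷ []) ∷ (# 0 ∷ # 3 ∷ # 6 ∷ []) ∷
   (# 2 ∷ # 5 ∷ # 9 ∷ []) ∷ (# 1 ∷ # 6 ∷ # 9 ∷ []) ∷ (# 2 ∷ # 3 ∷ # 8 ∷ []) ∷ (# 1 ∷ # 4 ∷ # 7 ∷ []) ∷
   (# 0 ∷ # 5 ∷ # 7 ∷ []) ∷ (# 3 ∷ # 4 ∷ # 9 ∷ []) ∷ [])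
  (forcedIn ∷ forcedIn ∷ forcedIn ∷ forcedIn ∷ free ∷ free ∷ forcedOut ∷ forcedOut ∷ forcedOut ∷ forcedOut ∷ [])
  (# 1 ∷ # 2 ∷ # 9 ∷ [])
  (0 ∷ 2 ∷ 2 ∷ 1 ∷ 1 ∷ 1 ∷ 1 ∷ 1 ∷ 1 ∷ 2 ∷ [])
  _

extendable₁₁ : Extendable 11
extendable₁₁ = Tabulated.extendable
  ((# 0 ∷ # 1 ∷ # 10 ∷ []) ∷ (# 2 ∷ # 4 ∷ # 9 ∷ []) ∷ (# 3 ∷ # 9 ∷ # 10 ∷ []) ∷ (# 3 ∷ # 5 ∷ # 8 ∷ []) ∷
   (# 0 ∷ # 6 ∷ # 9 ∷ []) ∷ (# 3 ∷ # 6 ∷ # 7 ∷ []) ∷ (# 1 ∷ # 5 ∷ # 7 ∷ []) ∷ (# 2 ∷ # 6 ∷ # 8 ∷ []) ∷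
   (# 1 ∷ # 4 ∷ # 8 ∷ []) ∷ (# 0 ∷ # 4 ∷ # 7 ∷ []) ∷ (# 2 ∷ # 5 ∷ # 10 ∷ []) ∷ [])
  (forcedIn ∷ forcedIn ∷ forcedIn ∷ forcedIn ∷ free ∷ free ∷ free ∷ forcedOut ∷ forcedOut ∷ forcedOut ∷ forcedOut ∷ [])
  (# 0 ∷ # 1 ∷ # 3 ∷ [])
  (0 ∷ 1 ∷ 2 ∷ 2 ∷ 1 ∷ 2 ∷ 1 ∷ 1 ∷ 2 ∷ 1 ∷ 1 ∷ [])
  _

extendable : ∀ k → Extendable (9 + k)
extendable 0 = extendable₉
extendable 1 = extendable₁₀
extendable 2 = extendable₁₁
extendable (suc (suc (suc k))) = Extension.extended (extendable k)

theorem3 : (v : ℕ) → 9 ≤ v →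
    ∃[ C ] (IsConfiguration {v} C × Connected C ×
      ((q : ℕ) → ⌈ v /3⌉ ≤ q → q ≤ ⌊2 v /3⌋ →
        ∃[ Q ] (IsBlockingSet C Q × ∣ Q ∣ ≡ q)))
theorem3 v 9≤v with k , refl ← m≤n⇒∃[o]m+o≡n 9≤v =
  structure , isConfiguration , connected , allBlockingSizes
  where open Extendable (extendable k)
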